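{- Let $p$ be a prime, and work in the field of rational functions $\mathbb{F}_p(x,y)$ in two indeterminates. For every $m\ge3$, $$F_{m,p}=\nu^{\theta(m-3,p)}F_{m-1,p}+F_{m-2,p}.$$
   Context: For integers $i,j\ge0$, $[i,j]:=x^{p^i}y^{p^j}-x^{p^j}y^{p^i}\in\mathbb{F}_p[x,y]$ (nonzero for $i\neq j$). Let $\nu:=-\dfrac{[0,2][1,3]}{[0,1][2,3]}$. For $r\ge0$, $\theta(r,p):=\sum_{i=0}^{r}(-1)^{r-i}p^i=p^r-p^{r-1}+\cdots+(-1)^r$. Define $F_{1,p}=F_{2,p}:=1$ and, for $k\ge1$, $F_{2k+1,p}:=(-1)^k[0,2k+1]\,[0,1]^{ -\theta(2k,p)}$ and $F_{2k,p}:=(-1)^{k+1}\dfrac{[1,2]}{[0,1][0,2]}[0,2k]\,[0,1]^{ -\theta(2k-1,p)}$ (for $k=1$ this gives $F_{2,p}=1$, consistently). -}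

module Defs where

open import Data.Nat as ℕ using (ℕ; zero; suc; _∸_; _≟_)
import Data.Nat as N
open import Data.Integer as ℤ using (ℤ; +_; -_)
open import Data.Integer.Divisibility using (_∣_)
open import Data.Product using (_×_; _,_)
open import Data.List using (List; []; _∷_; _++_; map; concatMap; foldr)
open import Data.Bool using (Bool; true; false; if_then_else_)
open import Relation.Nullary.Decidable using (⌊_⌋)
open import Data.Bool using (_∧_)

-- Polynomials in F_p[x,y], represented by integer-coefficient term lists
-- (coefficient, exponent of x, exponent of y); the ring structure is
-- read modulo p via the setoid equality _≈P[_]_ below.

Term : Set
Term = ℤ × ℕ × ℕ

Poly : Set
Poly = List Term

coeff : Poly → ℕ → ℕ → ℤ
coeff [] i j = + 0
coeff ((c , a , b) ∷ P) i j =
  (if ⌊ a ≟ i ⌋ ∧ ⌊ b ≟ j ⌋ then c else + 0) ℤ.+ coeff P i j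

_≈P[_]_ : Poly → ℕ → Poly → Set
P ≈P[ p ] Q = ∀ i j → (+ p) ∣ (coeff P i j ℤ.- coeff Q i j)

0P 1P : Poly
0P = []
1P = (+ 1 , 0 , 0) ∷ []

_+P_ : Poly → Poly → Poly
P +P Q = P ++ Q

-P_ : Poly → Poly
-P P = map (λ { (c , a , b) → (ℤ.- c , a , b) }) P

_*P_ : Poly → Poly → Poly
P *P Q = concatMap (λ { (c , a , b) →
           map (λ { (d , e , f) → (c ℤ.* d , a N.+ e , b N.+ f) }) Q }) P

record Frac : Set where
  constructor _//_
  field
    num : Poly
    den : Poly
open Frac public

_≈[_]_ : Frac → ℕ → Frac → Set
a ≈[ p ] b = (num a *P den b) ≈P[ p ] (num b *P den a)

poly : Poly → Frac
poly P = P // 1P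

1F : Frac
1F = poly 1P

_+F_ : Frac → Frac → Frac
a +F b = ((num a *P den b) +P (num b *P den a)) // (den a *P den b)

-F_ : Frac → Frac
-F a = (-P num a) // den a

_*F_ : Frac → Frac → Frac
a *F b = (num a *P num b) // (den a *P den b)

invF : Frac → Frac
invF a = den a // num a

_^F_ : Frac → ℕ → Frac
a ^F zero = 1F
a ^F suc n = a *F (a ^F n)

sgn : ℕ → Frac
sgn zero = 1F
sgn (suc k) = -F sgn k

br : ℕ → ℕ → ℕ → Frac
br p i j = poly ((+ 1 , p N.^ i , p N.^ j) ∷ (ℤ.- + 1 , p N.^ j , p N.^ i) ∷ [])

ν : ℕ → Frac
ν p = -F ((br p 0 2 *F br p 1 3) *F invF (br p 0 1 *F br p 2 3))

-- θ(r,p) = p^r - p^{r-1} + ... + (-1)^r  (θ(r+1) = p^{r+1} - θ(r) ≥ 0)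
θ : ℕ → ℕ → ℕ
θ zero p = 1
θ (suc r) p = p N.^ suc r ∸ θ r p

-- F_{2k+1,p} for k ≥ 1
Fodd : ℕ → ℕ → Frac
Fodd p k = (sgn k *F br p 0 (2 N.* k N.+ 1)) *F invF (br p 0 1 ^F θ (2 N.* k) p)

-- F_{2k,p} for k ≥ 1
Feven : ℕ → ℕ → Frac
Feven p k = ((sgn (suc k) *F (br p 1 2 *F invF (br p 0 1 *F br p 0 2)))
              *F br p 0 (2 N.* k)) *F invF (br p 0 1 ^F θ (2 N.* k ∸ 1) p)

odd : ℕ → Bool
odd zero = false
odd (suc n) = if odd n then false else true

half : ℕ → ℕ
half zero = 0
half (suc n) = if odd n then suc (half n) else half n

-- F_{m,p} for m ≥ 1 (F_{0,p} is never used; set to 1)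
F : ℕ → ℕ → Frac
F p 0 = 1F
F p 1 = 1F
F p 2 = 1F
F p m@(suc (suc (suc _))) = if odd m then Fodd p (half m) else Feven p (half m)

-- Over 𝔽ₚ the Frobenius map is additive, so [i,j]^p = [i+1,j+1]; hence [0,1]^(pᵏ) = [k,k+1],
-- [0,2]^(pᵏ) = [k,k+2] and ν = -[0,2]^(p+1)/[0,1]^(p²+1), while (-1)^θ(r) = (-1)^(r+1).
-- After clearing denominators, the recurrence at m is the Plücker relation
--   [0,n][n+1,n+2] + [0,n+2][n,n+1] = [0,n+1][n,n+2],   n = m - 2,
-- multiplied by powers of [0,1] whose exponents agree because θ(r+1) + θ(r) = p^(r+1) and
-- pθ(r) - θ(r+1) = (-1)^r.

module Submission where

open import Defs
open import Data.Nat using (ℕ; zero; suc; _≤_; _∸_)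
open import Data.Nat.Primality using (Prime; prime⇒nonZero)

open import Algebra.Bundles using (CommutativeRing)
open import Algebra.Structures using (IsCommutativeRing)
import Algebra.Solver.Ring
open import Algebra.Solver.Ring.AlmostCommutativeRing using (fromCommutativeRing; _-Raw-AlmostCommutative⟶_)
open import Data.Bool using (true; false; if_then_else_; _∧_)
open import Data.Bool.Properties using (∧-zeroʳ)
open import Data.Empty using (⊥-elim)
open import Data.Integer as ℤ using (ℤ; +_)
import Data.Integer.Divisibility.Signed as ℤ∣
import Data.Integer.Properties as ℤ
open import Data.Maybe using (Maybe; just; nothing)
open import Data.List using ([]; _∷_; _++_; map)
import Data.List.Properties as List
import Data.Nat as ℕ
import Data.Nat.Properties as ℕ
open import Data.Product using (_,_)
open import Data.Sum using (_⊎_; inj₁; inj₂)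
open import Function using (_∘_)
open import Level using (0ℓ)
open import Relation.Binary.PropositionalEquality as ≡
  using (_≡_; cong; cong₂; subst; subst₂; module ≡-Reasoning)
open import Relation.Binary.Structures using (IsEquivalence)
open import Relation.Nullary using (¬_; Dec; yes; no)
open import Relation.Nullary.Decidable using (⌊_⌋)

module Coefficients where
  open import Data.Integer.Tactic.RingSolver using (solve-∀)
  open ≡ using (refl; sym; trans)

  infix 4 _≐_

  _≐_ : Poly → Poly → Set
  P ≐ Q = ∀ i j → coeff P i j ≡ coeff Q i j

  term-coeff : Term → ℕ → ℕ → ℤ
  term-coeff (c , a , b) i j = if ⌊ a ℕ.≟ i ⌋ ∧ ⌊ b ℕ.≟ j ⌋ then c else + 0

  coeff-++ : ∀ P Q i j → coeff (P ++ Q) i j ≡ coeff P i j ℤ.+ coeff Q i j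
  coeff-++ []                Q i j = sym (ℤ.+-identityˡ _)
  coeff-++ (t ∷ P) Q i j = trans (cong (ℤ._+_ (term-coeff t i j)) (coeff-++ P Q i j))
                                 (sym (ℤ.+-assoc (term-coeff t i j) (coeff P i j) _))

  coeff-neg : ∀ P i j → coeff (-P P) i j ≡ ℤ.- coeff P i j
  coeff-neg []                i j = refl
  coeff-neg ((c , a , b) ∷ P) i j = trans
    (cong₂ ℤ._+_ (if-neg (⌊ a ℕ.≟ i ⌋ ∧ ⌊ b ℕ.≟ j ⌋)) (coeff-neg P i j))
    (sym (ℤ.neg-distrib-+ (term-coeff (c , a , b) i j) (coeff P i j)))
    where
    if-neg : ∀ B → (if B then ℤ.- c else + 0) ≡ ℤ.- (if B then c else + 0)
    if-neg true  = refl
    if-neg false = refl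

  scale : Term → Term → Term
  scale (c , a , b) (d , e , f) = (c ℤ.* d , a ℕ.+ e , b ℕ.+ f)

  ⌊+≟+⌋ : ∀ a m n → ⌊ a ℕ.+ m ℕ.≟ a ℕ.+ n ⌋ ≡ ⌊ m ℕ.≟ n ⌋
  ⌊+≟+⌋ a m n with a ℕ.+ m ℕ.≟ a ℕ.+ n | m ℕ.≟ n
  ... | yes _  | yes _  = refl
  ... | no  _  | no  _  = refl
  ... | yes eq | no  ne = ⊥-elim (ne (ℕ.+-cancelˡ-≡ a m n eq))
  ... | no  ne | yes eq = ⊥-elim (ne (cong (a ℕ.+_) eq))

  coeff-scale : ∀ c a b Q i j →
    coeff (map (scale (c , a , b)) Q) (a ℕ.+ i) (b ℕ.+ j) ≡ c ℤ.* coeff Q i j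
  coeff-scale c a b []                i j = sym (ℤ.*-zeroʳ c)
  coeff-scale c a b ((d , e , f) ∷ Q) i j
    rewrite ⌊+≟+⌋ a e i | ⌊+≟+⌋ b f j = trans
      (cong₂ ℤ._+_ (if-* (⌊ e ℕ.≟ i ⌋ ∧ ⌊ f ℕ.≟ j ⌋)) (coeff-scale c a b Q i j))
      (sym (ℤ.*-distribˡ-+ c _ (coeff Q i j)))
    where
    if-* : ∀ B → (if B then c ℤ.* d else + 0) ≡ c ℤ.* (if B then d else + 0)
    if-* true  = refl
    if-* false = sym (ℤ.*-zeroʳ c)

  ⌊≟⌋-below : ∀ {a} e i → ¬ a ℕ.≤ i → ⌊ a ℕ.+ e ℕ.≟ i ⌋ ≡ false
  ⌊≟⌋-below {a} e i a≰i with a ℕ.+ e ℕ.≟ i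
  ... | yes refl = ⊥-elim (a≰i (ℕ.m≤m+n a e))
  ... | no  _    = refl

  coeff-scale-below : ∀ c a b Q i j → ¬ a ℕ.≤ i ⊎ ¬ b ℕ.≤ j →
    coeff (map (scale (c , a , b)) Q) i j ≡ + 0
  coeff-scale-below c a b []                i j out = refl
  coeff-scale-below c a b ((d , e , f) ∷ Q) i j (inj₁ a≰i)
    rewrite ⌊≟⌋-below e i a≰i = trans (ℤ.+-identityˡ _) (coeff-scale-below c a b Q i j (inj₁ a≰i))
  coeff-scale-below c a b ((d , e , f) ∷ Q) i j (inj₂ b≰j)
    rewrite ⌊≟⌋-below f j b≰j | ∧-zeroʳ ⌊ a ℕ.+ e ℕ.≟ i ⌋
    = trans (ℤ.+-identityˡ _) (coeff-scale-below c a b Q i j (inj₂ b≰j))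

  *P-zeroʳ : ∀ P → P *P [] ≡ []
  *P-zeroʳ []      = refl
  *P-zeroʳ (_ ∷ P) = *P-zeroʳ P

  *P-identityˡ : ∀ P → 1P *P P ≡ P
  *P-identityˡ []                = refl
  *P-identityˡ ((c , a , b) ∷ P) =
    cong₂ (λ c' Q → (c' , a , b) ∷ Q) (ℤ.*-identityˡ c) (*P-identityˡ P)

  *P-distribʳ : ∀ R P Q → (P ++ Q) *P R ≡ (P *P R) ++ (Q *P R)
  *P-distribʳ R P Q = List.concatMap-++ (λ t → map (scale t) R) P Q

  scale-assoc : ∀ s t u → scale s (scale t u) ≡ scale (scale s t) u
  scale-assoc (c , a , b) (d , e , f) (g , h , k) =
    cong₂ _,_ (sym (ℤ.*-assoc c d g)) (cong₂ _,_ (sym (ℕ.+-assoc a e h)) (sym (ℕ.+-assoc b f k)))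

  map-scale-*P : ∀ s Q R → map (scale s) Q *P R ≡ map (scale s) (Q *P R)
  map-scale-*P s []      R = refl
  map-scale-*P s (t ∷ Q) R = begin
    map (scale (scale s t)) R ++ (map (scale s) Q *P R)
      ≡⟨ cong₂ _++_ (List.map-cong (sym ∘ scale-assoc s t) R) (map-scale-*P s Q R) ⟩
    map (scale s ∘ scale t) R ++ map (scale s) (Q *P R)
      ≡⟨ cong (_++ map (scale s) (Q *P R)) (List.map-∘ R) ⟩
    map (scale s) (map (scale t) R) ++ map (scale s) (Q *P R)
      ≡⟨ List.map-++ (scale s) (map (scale t) R) (Q *P R) ⟨
    map (scale s) (map (scale t) R ++ (Q *P R)) ∎
    where open ≡-Reasoning

  *P-assoc : ∀ P Q R → (P *P Q) *P R ≡ P *P (Q *P R)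
  *P-assoc []      Q R = refl
  *P-assoc (s ∷ P) Q R = begin
    (map (scale s) Q ++ (P *P Q)) *P R          ≡⟨ *P-distribʳ R (map (scale s) Q) (P *P Q) ⟩
    (map (scale s) Q *P R) ++ ((P *P Q) *P R)   ≡⟨ cong₂ _++_ (map-scale-*P s Q R) (*P-assoc P Q R) ⟩
    map (scale s) (Q *P R) ++ (P *P (Q *P R))   ∎
    where open ≡-Reasoning

  scale-comm : ∀ s t → scale s t ≡ scale t s
  scale-comm (c , a , b) (d , e , f) =
    cong₂ _,_ (ℤ.*-comm c d) (cong₂ _,_ (ℕ.+-comm a e) (ℕ.+-comm b f))

  *P-singletonʳ : ∀ t Q → Q *P (t ∷ []) ≡ map (scale t) Q
  *P-singletonʳ t []      = refl
  *P-singletonʳ t (s ∷ Q) = cong₂ _∷_ (scale-comm s t) (*P-singletonʳ t Q)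

  ≐-++ : ∀ P P' Q Q' → P ≐ P' → Q ≐ Q' → P ++ Q ≐ P' ++ Q'
  ≐-++ P P' Q Q' eP eQ i j = begin
    coeff (P ++ Q) i j              ≡⟨ coeff-++ P Q i j ⟩
    coeff P i j ℤ.+ coeff Q i j     ≡⟨ cong₂ ℤ._+_ (eP i j) (eQ i j) ⟩
    coeff P' i j ℤ.+ coeff Q' i j   ≡⟨ coeff-++ P' Q' i j ⟨
    coeff (P' ++ Q') i j            ∎
    where open ≡-Reasoning

  ++-interchange : ∀ P Q R S → (P ++ Q) ++ (R ++ S) ≐ (P ++ R) ++ (Q ++ S)
  ++-interchange P Q R S i j = begin
    coeff ((P ++ Q) ++ (R ++ S)) i j
      ≡⟨ trans (coeff-++ (P ++ Q) (R ++ S) i j) (cong₂ ℤ._+_ (coeff-++ P Q i j) (coeff-++ R S i j)) ⟩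
    (coeff P i j ℤ.+ coeff Q i j) ℤ.+ (coeff R i j ℤ.+ coeff S i j)
      ≡⟨ interchange (coeff P i j) (coeff Q i j) (coeff R i j) (coeff S i j) ⟩
    (coeff P i j ℤ.+ coeff R i j) ℤ.+ (coeff Q i j ℤ.+ coeff S i j)
      ≡⟨ trans (coeff-++ (P ++ R) (Q ++ S) i j) (cong₂ ℤ._+_ (coeff-++ P R i j) (coeff-++ Q S i j)) ⟨
    coeff ((P ++ R) ++ (Q ++ S)) i j ∎
    where
    open ≡-Reasoning
    interchange : ∀ w x y z → (w ℤ.+ x) ℤ.+ (y ℤ.+ z) ≡ (w ℤ.+ y) ℤ.+ (x ℤ.+ z)
    interchange = solve-∀

  *P-distribˡ : ∀ R P Q → R *P (P ++ Q) ≐ (R *P P) ++ (R *P Q)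
  *P-distribˡ []      P Q i j = refl
  *P-distribˡ (s ∷ R) P Q i j = begin
    coeff (map (scale s) (P ++ Q) ++ R *P (P ++ Q)) i j
      ≡⟨ cong (λ X → coeff (X ++ R *P (P ++ Q)) i j) (List.map-++ (scale s) P Q) ⟩
    coeff ((map (scale s) P ++ map (scale s) Q) ++ R *P (P ++ Q)) i j
      ≡⟨ ≐-++ (map (scale s) P ++ map (scale s) Q) (map (scale s) P ++ map (scale s) Q)
              (R *P (P ++ Q)) (R *P P ++ R *P Q) (λ _ _ → refl) (*P-distribˡ R P Q) i j ⟩
    coeff ((map (scale s) P ++ map (scale s) Q) ++ ((R *P P) ++ (R *P Q))) i j
      ≡⟨ ++-interchange (map (scale s) P) (map (scale s) Q) (R *P P) (R *P Q) i j ⟩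
    coeff ((map (scale s) P ++ R *P P) ++ (map (scale s) Q ++ R *P Q)) i j ∎
    where open ≡-Reasoning

  *P-comm : ∀ P Q → P *P Q ≐ Q *P P
  *P-comm []      Q i j = cong (λ X → coeff X i j) (sym (*P-zeroʳ Q))
  *P-comm (s ∷ P) Q i j = begin
    coeff (map (scale s) Q ++ P *P Q) i j
      ≡⟨ ≐-++ (map (scale s) Q) (Q *P (s ∷ [])) (P *P Q) (Q *P P)
              (λ i j → cong (λ X → coeff X i j) (sym (*P-singletonʳ s Q))) (*P-comm P Q) i j ⟩
    coeff (Q *P (s ∷ []) ++ Q *P P) i j
      ≡⟨ *P-distribˡ Q (s ∷ []) P i j ⟨
    coeff (Q *P (s ∷ P)) i j ∎
    where open ≡-Reasoning

module Modular (p : ℕ) where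
  open import Data.Integer.Tactic.RingSolver using (solve-∀)
  open Coefficients
  open ≡ using (refl; sym; trans)

  infix 4 _∼_ _≋_

  record _∼_ (x y : ℤ) : Set where
    constructor divides-diff
    field diff-divisible : + p ℤ∣.∣ (x ℤ.- y)
  open _∼_ public

  ≡⇒∼ : ∀ {x y} → x ≡ y → x ∼ y
  ≡⇒∼ {x} refl = divides-diff (subst (+ p ℤ∣.∣_) (sym (ℤ.+-inverseʳ x)) (ℤ∣.divides (+ 0) refl))

  ∼-sym : ∀ {x y} → x ∼ y → y ∼ x
  ∼-sym {x} {y} (divides-diff p∣) =
    divides-diff (subst (+ p ℤ∣.∣_) (rearrange x y) (ℤ∣.∣m⇒∣-m p∣))
    where
    rearrange : ∀ x y → ℤ.- (x ℤ.- y) ≡ y ℤ.- x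
    rearrange = solve-∀

  ∼-trans : ∀ {x y z} → x ∼ y → y ∼ z → x ∼ z
  ∼-trans {x} {y} {z} (divides-diff p∣) (divides-diff p∣') =
    divides-diff (subst (+ p ℤ∣.∣_) (rearrange x y z) (ℤ∣.∣m∣n⇒∣m+n p∣ p∣'))
    where
    rearrange : ∀ x y z → (x ℤ.- y) ℤ.+ (y ℤ.- z) ≡ x ℤ.- z
    rearrange = solve-∀

  ∼-+ : ∀ {x x' y y'} → x ∼ x' → y ∼ y' → x ℤ.+ y ∼ x' ℤ.+ y'
  ∼-+ {x} {x'} {y} {y'} (divides-diff p∣) (divides-diff p∣') =
    divides-diff (subst (+ p ℤ∣.∣_) (rearrange x x' y y') (ℤ∣.∣m∣n⇒∣m+n p∣ p∣'))
    where
    rearrange : ∀ x x' y y' → (x ℤ.- x') ℤ.+ (y ℤ.- y') ≡ (x ℤ.+ y) ℤ.- (x' ℤ.+ y')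
    rearrange = solve-∀

  ∼-neg : ∀ {x y} → x ∼ y → ℤ.- x ∼ ℤ.- y
  ∼-neg {x} {y} (divides-diff p∣) =
    divides-diff (subst (+ p ℤ∣.∣_) (rearrange x y) (ℤ∣.∣m⇒∣-m p∣))
    where
    rearrange : ∀ x y → ℤ.- (x ℤ.- y) ≡ ℤ.- x ℤ.- ℤ.- y
    rearrange = solve-∀

  ∼-*ˡ : ∀ c {x y} → x ∼ y → c ℤ.* x ∼ c ℤ.* y
  ∼-*ˡ c {x} {y} (divides-diff p∣) =
    divides-diff (subst (+ p ℤ∣.∣_) (rearrange c x y) (ℤ∣.∣n⇒∣m*n c p∣))
    where
    rearrange : ∀ c x y → c ℤ.* (x ℤ.- y) ≡ c ℤ.* x ℤ.- c ℤ.* y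
    rearrange = solve-∀

  record _≋_ (P Q : Poly) : Set where
    constructor coeffs∼
    field coeff∼ : ∀ i j → coeff P i j ∼ coeff Q i j
  open _≋_ public

  ≐⇒≋ : ∀ {P Q} → P ≐ Q → P ≋ Q
  ≐⇒≋ P≐Q = coeffs∼ λ i j → ≡⇒∼ (P≐Q i j)

  ≡⇒≋ : ∀ {P Q} → P ≡ Q → P ≋ Q
  ≡⇒≋ refl = ≐⇒≋ λ _ _ → refl

  ≋-isEquivalence : IsEquivalence _≋_
  ≋-isEquivalence = record
    { refl  = ≡⇒≋ refl
    ; sym   = λ P≋Q → coeffs∼ λ i j → ∼-sym (coeff∼ P≋Q i j)
    ; trans = λ P≋Q Q≋R → coeffs∼ λ i j → ∼-trans (coeff∼ P≋Q i j) (coeff∼ Q≋R i j)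
    }

  ++-cong : ∀ {P P' Q Q'} → P ≋ P' → Q ≋ Q' → P ++ Q ≋ P' ++ Q'
  ++-cong {P} {P'} {Q} {Q'} P≋P' Q≋Q' = coeffs∼ λ i j →
    subst₂ _∼_ (sym (coeff-++ P Q i j)) (sym (coeff-++ P' Q' i j))
      (∼-+ (coeff∼ P≋P' i j) (coeff∼ Q≋Q' i j))

  -P-cong : ∀ {P P'} → P ≋ P' → -P P ≋ -P P'
  -P-cong {P} {P'} P≋P' = coeffs∼ λ i j →
    subst₂ _∼_ (sym (coeff-neg P i j)) (sym (coeff-neg P' i j)) (∼-neg (coeff∼ P≋P' i j))

  scale-cong : ∀ t {Q Q'} → Q ≋ Q' → map (scale t) Q ≋ map (scale t) Q'
  scale-cong (c , a , b) {Q} {Q'} Q≋Q' = coeffs∼ λ i j → shifted i j (a ℕ.≤? i) (b ℕ.≤? j)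
    where
    t = (c , a , b)
    shifted : ∀ i j → Dec (a ℕ.≤ i) → Dec (b ℕ.≤ j) →
              coeff (map (scale t) Q) i j ∼ coeff (map (scale t) Q') i j
    shifted i j (yes a≤i) (yes b≤j) =
      subst₂ (λ i j → coeff (map (scale t) Q) i j ∼ coeff (map (scale t) Q') i j)
        (ℕ.m+[n∸m]≡n a≤i) (ℕ.m+[n∸m]≡n b≤j)
        (subst₂ _∼_ (sym (coeff-scale c a b Q _ _)) (sym (coeff-scale c a b Q' _ _))
          (∼-*ˡ c (coeff∼ Q≋Q' (i ∸ a) (j ∸ b))))
    shifted i j (no a≰i) _ = ≡⇒∼ (trans (coeff-scale-below c a b Q i j (inj₁ a≰i))
                                        (sym (coeff-scale-below c a b Q' i j (inj₁ a≰i))))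
    shifted i j _ (no b≰j) = ≡⇒∼ (trans (coeff-scale-below c a b Q i j (inj₂ b≰j))
                                        (sym (coeff-scale-below c a b Q' i j (inj₂ b≰j))))

  *P-congˡ : ∀ P {Q Q'} → Q ≋ Q' → P *P Q ≋ P *P Q'
  *P-congˡ []      Q≋Q' = ≡⇒≋ refl
  *P-congˡ (t ∷ P) Q≋Q' = ++-cong (scale-cong t Q≋Q') (*P-congˡ P Q≋Q')

  private
    module ≋ = IsEquivalence ≋-isEquivalence

  *P-cong : ∀ {P P' Q Q'} → P ≋ P' → Q ≋ Q' → P *P Q ≋ P' *P Q'
  *P-cong {P} {P'} {Q} {Q'} P≋P' Q≋Q' = ≋.trans (*P-congˡ P Q≋Q')
    (≋.trans (≐⇒≋ (*P-comm P Q')) (≋.trans (*P-congˡ Q' P≋P') (≐⇒≋ (*P-comm Q' P'))))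

  ++-comm : ∀ P Q → P ++ Q ≋ Q ++ P
  ++-comm P Q = ≐⇒≋ λ i j → trans (coeff-++ P Q i j)
    (trans (ℤ.+-comm (coeff P i j) (coeff Q i j)) (sym (coeff-++ Q P i j)))

  -P-inverseˡ : ∀ P → -P P ++ P ≋ []
  -P-inverseˡ P = ≐⇒≋ λ i j → trans (coeff-++ (-P P) P i j)
    (trans (cong (ℤ._+ coeff P i j) (coeff-neg P i j)) (ℤ.+-inverseˡ (coeff P i j)))

  infixl 6 _⊕_
  infixl 7 _⊗_
  infix  8 ⊖_

  -- Opaque, so that unification does not unfold ring expressions into list computations,
  -- which would defeat the inference of implicit arguments in ring reasoning.
  opaque
    _⊕_ _⊗_ : Poly → Poly → Poly
    _⊕_ = _++_
    _⊗_ = _*P_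

    ⊖_ : Poly → Poly
    ⊖_ = -P_

  opaque
    unfolding _⊕_ _⊗_

    isCommutativeRing : IsCommutativeRing _≋_ _⊕_ _⊗_ ⊖_ [] 1P
    isCommutativeRing = record
      { isRing = record
        { +-isAbelianGroup = record
          { isGroup = record
            { isMonoid = record
              { isSemigroup = record
                { isMagma = record { isEquivalence = ≋-isEquivalence ; ∙-cong = ++-cong }
                ; assoc   = λ P Q R → ≡⇒≋ (List.++-assoc P Q R)
                }
              ; identity = (λ _ → ≋.refl) , (λ P → ≡⇒≋ (List.++-identityʳ P))
              }
            ; inverse = -P-inverseˡ , (λ P → ≋.trans (++-comm P (-P P)) (-P-inverseˡ P))
            ; ⁻¹-cong = -P-cong
            }
          ; comm = ++-comm
          }
        ; *-cong     = *P-cong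
        ; *-assoc    = λ P Q R → ≡⇒≋ (*P-assoc P Q R)
        ; *-identity = (λ P → ≡⇒≋ (*P-identityˡ P))
                     , (λ P → ≋.trans (≐⇒≋ (*P-comm P 1P)) (≡⇒≋ (*P-identityˡ P)))
        ; distrib    = (λ R P Q → ≐⇒≋ (*P-distribˡ R P Q))
                     , (λ R P Q → ≡⇒≋ (*P-distribʳ R P Q))
        }
      ; *-comm = λ P Q → ≐⇒≋ (*P-comm P Q)
      }

    ++≡⊕ : ∀ P Q → P ++ Q ≡ P ⊕ Q
    ++≡⊕ P Q = refl

    *P≡⊗ : ∀ P Q → P *P Q ≡ P ⊗ Q
    *P≡⊗ P Q = refl

    -P≡⊖ : ∀ P → -P P ≡ ⊖ P
    -P≡⊖ P = refl

  commutativeRing : CommutativeRing 0ℓ 0ℓ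
  commutativeRing = record { isCommutativeRing = isCommutativeRing }

  open import Algebra.Properties.Semiring.Mult (CommutativeRing.semiring commutativeRing) using (_×_)

  ×-coeff : ∀ n P i j → coeff (n × P) i j ≡ + n ℤ.* coeff P i j
  ×-coeff zero    P i j = sym (ℤ.*-zeroˡ (coeff P i j))
  ×-coeff (suc n) P i j = begin
    coeff (P ⊕ n × P) i j                     ≡⟨ cong (λ X → coeff X i j) (++≡⊕ P (n × P)) ⟨
    coeff (P ++ n × P) i j                    ≡⟨ coeff-++ P (n × P) i j ⟩
    coeff P i j ℤ.+ coeff (n × P) i j         ≡⟨ cong (ℤ._+_ (coeff P i j)) (×-coeff n P i j) ⟩
    coeff P i j ℤ.+ + n ℤ.* coeff P i j       ≡⟨ factor (coeff P i j) (+ n) ⟩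
    (+ 1 ℤ.+ + n) ℤ.* coeff P i j             ∎
    where
    open ≡-Reasoning
    factor : ∀ c m → c ℤ.+ m ℤ.* c ≡ (+ 1 ℤ.+ m) ℤ.* c
    factor = solve-∀

  characteristic : p × 1P ≋ []
  characteristic = coeffs∼ λ i j → divides-diff (subst (+ p ℤ∣.∣_)
    (sym (trans (ℤ.+-identityʳ _) (×-coeff p 1P i j))) (ℤ∣.∣m⇒∣m*n (coeff 1P i j) ℤ∣.∣-refl))

  constant : ℤ → Poly
  constant c = (c , 0 , 0) ∷ []

  constant-+ : ∀ c d → constant (c ℤ.+ d) ≋ constant c ⊕ constant d
  constant-+ c d = subst (constant (c ℤ.+ d) ≋_) (++≡⊕ (constant c) (constant d))
    (≐⇒≋ λ i j → by-cases (⌊ 0 ℕ.≟ i ⌋ ∧ ⌊ 0 ℕ.≟ j ⌋))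
    where
    by-cases : ∀ B → (if B then c ℤ.+ d else + 0) ℤ.+ + 0
                ≡ (if B then c else + 0) ℤ.+ ((if B then d else + 0) ℤ.+ + 0)
    by-cases true  = trans (ℤ.+-identityʳ _) (cong (ℤ._+_ c) (sym (ℤ.+-identityʳ d)))
    by-cases false = refl

  constant-0 : constant (+ 0) ≋ []
  constant-0 = ≐⇒≋ λ i j → by-cases (⌊ 0 ℕ.≟ i ⌋ ∧ ⌊ 0 ℕ.≟ j ⌋)
    where
    by-cases : ∀ B → (if B then + 0 else + 0) ℤ.+ + 0 ≡ + 0
    by-cases true  = refl
    by-cases false = refl

  constant-homomorphism : ℤ.+-*-rawRing -Raw-AlmostCommutative⟶ fromCommutativeRing commutativeRing
  constant-homomorphism = record
    { ⟦_⟧    = constant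
    ; +-homo = constant-+
    ; *-homo = λ c d → ≡⇒≋ (*P≡⊗ (constant c) (constant d))
    ; -‿homo = λ c → ≡⇒≋ (-P≡⊖ (constant c))
    ; 0-homo = constant-0
    ; 1-homo = ≋.refl
    }

  constant-≟ : ∀ c d → Maybe (constant c ≋ constant d)
  constant-≟ c d with c ℤ.≟ d
  ... | yes refl = just ≋.refl
  ... | no  _    = nothing

  module Solver = Algebra.Solver.Ring ℤ.+-*-rawRing (fromCommutativeRing commutativeRing)
                                      constant-homomorphism constant-≟

module _ {p : ℕ} (p-prime : Prime p) where
  open ≡ using (refl; sym; trans)
  open import Data.Nat.Combinatorics using (_C_; nCk≡n!/k![n-k]!; k![n∸k]!∣n!)
  open import Data.Nat.DivMod using (m/n*n≡m)
  open import Data.Nat.Divisibility using (_∣_; ∣⇒≤; m∣m*n)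
  open import Data.Nat.Primality using (euclidsLemma; prime⇒nonTrivial)
  open import Data.Nat using (_!; _<_)

  private
    1<p : 1 < p
    1<p = ℕ.nonTrivial⇒n>1 p {{prime⇒nonTrivial p-prime}}

  prime∤! : ∀ {j} → j < p → ¬ p ∣ j !
  prime∤! {zero}  _   p∣1 = ℕ.<⇒≱ 1<p (∣⇒≤ p∣1)
  prime∤! {suc j} j<p p∣j! with euclidsLemma (suc j) (j !) p-prime p∣j!
  ... | inj₁ p∣1+j = ℕ.<⇒≱ j<p (∣⇒≤ p∣1+j)
  ... | inj₂ p∣j!  = prime∤! (ℕ.<-trans (ℕ.n<1+n j) j<p) p∣j!

  prime∣binomial : ∀ {k} → 0 < k → k < p → p ∣ p C k
  prime∣binomial {k} 0<k k<p
    with euclidsLemma (p C k) (k ! ℕ.* (p ∸ k) !) p-prime (subst (p ∣_) (sym C*factorials) p∣p!)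
    where
    instance _ = k ℕ.!* (p ∸ k) !≢0
    k≤p = ℕ.<⇒≤ k<p
    C*factorials : (p C k) ℕ.* (k ! ℕ.* (p ∸ k) !) ≡ p !
    C*factorials = trans (cong (ℕ._* (k ! ℕ.* (p ∸ k) !)) (nCk≡n!/k![n-k]! k≤p))
                         (m/n*n≡m (k![n∸k]!∣n! k≤p))
    n∣n! : ∀ n → .{{ℕ.NonZero n}} → n ∣ n !
    n∣n! (suc n) = m∣m*n (n !)
    p∣p! : p ∣ p !
    p∣p! = n∣n! p {{prime⇒nonZero p-prime}}
  ... | inj₁ p∣C = p∣C
  ... | inj₂ p∣k!*[p∸k]! with euclidsLemma (k !) ((p ∸ k) !) p-prime p∣k!*[p∸k]!
  ...   | inj₁ p∣k!     = ⊥-elim (prime∤! k<p p∣k!)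
  ...   | inj₂ p∣[p∸k]! = ⊥-elim (prime∤! (ℕ.∸-monoʳ-< 0<k (ℕ.<⇒≤ k<p)) p∣[p∸k]!)

module Frobenius {c ℓ} (R : CommutativeRing c ℓ) where
  open CommutativeRing R
  open import Algebra.Properties.Semiring.Exp semiring using (_^_; ^-congˡ; ^-assocʳ)
  open import Algebra.Properties.CommutativeSemiring.Exp commutativeSemiring using (^-distrib-*)
  open import Algebra.Properties.Semiring.Mult semiring using (_×_; ×-congʳ; ×-assoc-*; ×1-homo-*)
  open import Algebra.Properties.Semiring.Sum semiring using (sum; sum-init-last; sum-cong-≋; sum-replicate-zero)
  import Algebra.Properties.CommutativeSemiring.Binomial commutativeSemiring as Binomial
  open import Algebra.Properties.Group +-group using (inverseʳ-unique)
  open import Algebra.Properties.Ring ring using (-1*x≈-x)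
  open import Data.Fin using (toℕ; inject₁; fromℕ)
  import Data.Fin as Fin
  import Data.Fin.Properties as Fin
  open import Data.Nat.Combinatorics using (_C_; nCn≡1)
  open import Data.Nat.Divisibility using (_∣_; divides)
  open import Relation.Binary.Reasoning.Setoid setoid

  1#^ : ∀ n → 1# ^ n ≈ 1#
  1#^ zero    = refl
  1#^ (suc n) = trans (*-identityˡ _) (1#^ n)

  module _ {p} (p-prime : Prime p) (char : p × 1# ≈ 0#) where

    ×-char : ∀ {n} x → p ∣ n → n × x ≈ 0#
    ×-char {n} x (divides q ≡.refl) = begin
      n × x                        ≈⟨ ×-congʳ n (*-identityˡ x) ⟨
      n × (1# * x)                 ≈⟨ ×-assoc-* n 1# x ⟨
      (n × 1#) * x                 ≈⟨ *-congʳ (×1-homo-* q p) ⟩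
      ((q × 1#) * (p × 1#)) * x    ≈⟨ *-congʳ (*-congˡ char) ⟩
      ((q × 1#) * 0#) * x          ≈⟨ *-congʳ (zeroʳ (q × 1#)) ⟩
      0# * x                       ≈⟨ zeroˡ x ⟩
      0#                           ∎

    private
      1+q≡p : suc (ℕ.pred p) ≡ p
      1+q≡p = ℕ.suc-pred p {{prime⇒nonZero p-prime}}

      frobenius-suc : ∀ q → suc q ≡ p → ∀ x y → (x + y) ^ suc q ≈ x ^ suc q + y ^ suc q
      frobenius-suc q ≡.refl x y = begin
        (x + y) ^ p                                        ≈⟨ Binomial.theorem p x y ⟩
        sum t                                              ≈⟨ +-congˡ (sum-init-last (t ∘ Fin.suc)) ⟩
        t Fin.zero + (sum (t ∘ Fin.suc ∘ inject₁) + t (Fin.suc (fromℕ q)))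
          ≈⟨ +-cong first (+-cong (trans (sum-cong-≋ middle) (sum-replicate-zero q)) last) ⟩
        y ^ p + (0# + x ^ p)                               ≈⟨ +-congˡ (+-identityˡ (x ^ p)) ⟩
        y ^ p + x ^ p                                      ≈⟨ +-comm (y ^ p) (x ^ p) ⟩
        x ^ p + y ^ p                                      ∎
        where
        t = Binomial.binomialTerm x y p
        first : t Fin.zero ≈ y ^ p
        first = trans (+-identityʳ _) (*-identityˡ (y ^ p))
        last : t (Fin.suc (fromℕ q)) ≈ x ^ p
        last rewrite Fin.toℕ-fromℕ q | nCn≡1 p | ℕ.n∸n≡0 q =
          trans (+-identityʳ _) (*-identityʳ (x ^ p))
        middle : ∀ k → t (Fin.suc (inject₁ k)) ≈ 0#
        middle k = ×-char _ (prime∣binomial p-prime (ℕ.s≤s ℕ.z≤n)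
          (ℕ.s≤s (subst (ℕ._< q) (≡.sym (Fin.toℕ-inject₁ k)) (Fin.toℕ<n k))))

    frobenius-+ : ∀ x y → (x + y) ^ p ≈ x ^ p + y ^ p
    frobenius-+ = subst (λ n → ∀ x y → (x + y) ^ n ≈ x ^ n + y ^ n) 1+q≡p
                        (frobenius-suc (ℕ.pred p) 1+q≡p)

    private
      0#^p : 0# ^ p ≈ 0#
      0#^p = subst (λ n → 0# ^ n ≈ 0#) 1+q≡p (zeroˡ _)

    -1^p : (- 1#) ^ p ≈ - 1#
    -1^p = inverseʳ-unique 1# ((- 1#) ^ p) (begin
      1# + (- 1#) ^ p       ≈⟨ +-congʳ (1#^ p) ⟨
      1# ^ p + (- 1#) ^ p   ≈⟨ frobenius-+ 1# (- 1#) ⟨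
      (1# - 1#) ^ p         ≈⟨ ^-congˡ p (-‿inverseʳ 1#) ⟩
      0# ^ p                ≈⟨ 0#^p ⟩
      0#                    ∎)

    frobenius-− : ∀ x y → (x - y) ^ p ≈ x ^ p - y ^ p
    frobenius-− x y = begin
      (x - y) ^ p               ≈⟨ frobenius-+ x (- y) ⟩
      x ^ p + (- y) ^ p         ≈⟨ +-congˡ (^-congˡ p (-1*x≈-x y)) ⟨
      x ^ p + (- 1# * y) ^ p    ≈⟨ +-congˡ (^-distrib-* (- 1#) y p) ⟩
      x ^ p + (- 1#) ^ p * y ^ p ≈⟨ +-congˡ (*-congʳ -1^p) ⟩
      x ^ p + - 1# * y ^ p      ≈⟨ +-congˡ (-1*x≈-x (y ^ p)) ⟩
      x ^ p - y ^ p             ∎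

    -1^pᵏ : ∀ k → (- 1#) ^ (p ℕ.^ k) ≈ - 1#
    -1^pᵏ zero    = *-identityʳ (- 1#)
    -1^pᵏ (suc k) = begin
      (- 1#) ^ (p ℕ.* p ℕ.^ k)    ≈⟨ ^-assocʳ (- 1#) p (p ℕ.^ k) ⟨
      ((- 1#) ^ p) ^ (p ℕ.^ k)    ≈⟨ ^-congˡ (p ℕ.^ k) -1^p ⟩
      (- 1#) ^ (p ℕ.^ k)          ≈⟨ -1^pᵏ k ⟩
      - 1#                        ∎

module Brackets (p : ℕ) where
  open Modular p using (commutativeRing; characteristic; *P≡⊗; module Solver)
  open CommutativeRing commutativeRing
  open import Algebra.Properties.Semiring.Exp semiring using (_^_; ^-congˡ; ^-assocʳ)
  open Solver using (solve; _:=_; _:+_; _:*_; _:-_)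
  open import Relation.Binary.Reasoning.Setoid setoid

  monomial : ℕ → ℕ → Poly
  monomial a b = (+ 1 , a , b) ∷ []

  monomial-* : ∀ a b c d → monomial a b * monomial c d ≡ monomial (a ℕ.+ c) (b ℕ.+ d)
  monomial-* a b c d = ≡.sym (*P≡⊗ (monomial a b) (monomial c d))

  monomial-^ : ∀ a b n → monomial a b ^ n ≡ monomial (n ℕ.* a) (n ℕ.* b)
  monomial-^ a b zero    = ≡.refl
  monomial-^ a b (suc n) =
    ≡.trans (cong (monomial a b *_) (monomial-^ a b n)) (monomial-* a b (n ℕ.* a) (n ℕ.* b))

  [_,_] : ℕ → ℕ → Poly
  [ i , j ] = monomial (p ℕ.^ i) (p ℕ.^ j) - monomial (p ℕ.^ j) (p ℕ.^ i)

  plücker : ∀ a b c d → [ a , b ] * [ c , d ] + [ a , d ] * [ b , c ] ≈ [ a , c ] * [ b , d ]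
  plücker a b c d = begin
    [ a , b ] * [ c , d ] + [ a , d ] * [ b , c ]
      ≈⟨ +-cong (*-cong (xy a b) (xy c d)) (*-cong (xy a d) (xy b c)) ⟩
    (x a * y b - x b * y a) * (x c * y d - x d * y c) + (x a * y d - x d * y a) * (x b * y c - x c * y b)
      ≈⟨ solve 8 (λ xa xb xc xd ya yb yc yd →
           (xa :* yb :- xb :* ya) :* (xc :* yd :- xd :* yc) :+ (xa :* yd :- xd :* ya) :* (xb :* yc :- xc :* yb)
           := (xa :* yc :- xc :* ya) :* (xb :* yd :- xd :* yb))
           refl (x a) (x b) (x c) (x d) (y a) (y b) (y c) (y d) ⟩
    (x a * y c - x c * y a) * (x b * y d - x d * y b)
      ≈⟨ *-cong (xy a c) (xy b d) ⟨
    [ a , c ] * [ b , d ] ∎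
    where
    x y : ℕ → Poly
    x i = monomial (p ℕ.^ i) 0
    y j = monomial 0 (p ℕ.^ j)
    x*y : ∀ i j → x i * y j ≡ monomial (p ℕ.^ i) (p ℕ.^ j)
    x*y i j = ≡.trans (monomial-* (p ℕ.^ i) 0 0 (p ℕ.^ j))
                      (cong (λ a → monomial a (p ℕ.^ j)) (ℕ.+-identityʳ (p ℕ.^ i)))
    xy : ∀ i j → [ i , j ] ≈ x i * y j - x j * y i
    xy i j = reflexive (≡.sym (cong₂ _-_ (x*y i j) (x*y j i)))

  module _ (p-prime : Prime p) where
    open Frobenius commutativeRing using (frobenius-−)

    [,]^p : ∀ i j → [ i , j ] ^ p ≈ [ suc i , suc j ]
    [,]^p i j = begin
      [ i , j ] ^ p
        ≈⟨ frobenius-− p-prime characteristic _ _ ⟩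
      monomial (p ℕ.^ i) (p ℕ.^ j) ^ p - monomial (p ℕ.^ j) (p ℕ.^ i) ^ p
        ≡⟨ cong₂ _-_ (monomial-^ (p ℕ.^ i) (p ℕ.^ j) p) (monomial-^ (p ℕ.^ j) (p ℕ.^ i) p) ⟩
      [ suc i , suc j ] ∎

    [,]^pᵏ : ∀ k i j → [ i , j ] ^ (p ℕ.^ k) ≈ [ k ℕ.+ i , k ℕ.+ j ]
    [,]^pᵏ zero    i j = *-identityʳ [ i , j ]
    [,]^pᵏ (suc k) i j = begin
      [ i , j ] ^ (p ℕ.* p ℕ.^ k)         ≈⟨ ^-assocʳ [ i , j ] p (p ℕ.^ k) ⟨
      ([ i , j ] ^ p) ^ (p ℕ.^ k)         ≈⟨ ^-congˡ (p ℕ.^ k) ([,]^p i j) ⟩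
      [ suc i , suc j ] ^ (p ℕ.^ k)       ≈⟨ [,]^pᵏ k (suc i) (suc j) ⟩
      [ k ℕ.+ suc i , k ℕ.+ suc j ]       ≡⟨ cong₂ [_,_] (ℕ.+-suc k i) (ℕ.+-suc k j) ⟩
      [ suc k ℕ.+ i , suc k ℕ.+ j ]       ∎

double : ℕ → ℕ
double zero    = zero
double (suc n) = suc (suc (double n))

2*≡double : ∀ k → 2 ℕ.* k ≡ double k
2*≡double zero    = ≡.refl
2*≡double (suc k) = cong suc (≡.trans (ℕ.+-suc k (k ℕ.+ 0)) (cong suc (2*≡double k)))

odd-double : ∀ j → odd (double j) ≡ false
odd-double zero    = ≡.refl
odd-double (suc j) with odd (double j) | odd-double j
... | false | _ = ≡.refl

half-double : ∀ j → half (double j) ≡ j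
half-double zero    = ≡.refl
half-double (suc j) with odd (double j) | odd-double j
... | false | _ = cong suc (half-double j)

data Halving : ℕ → Set where
  twice   : ∀ j → Halving (double j)
  twice+1 : ∀ j → Halving (suc (double j))

halving : ∀ n → Halving n
halving zero = twice 0
halving (suc n) with halving n
... | twice j   = twice+1 j
... | twice+1 j = twice (suc j)

F-odd : ∀ p j → F p (3 ℕ.+ double j) ≡ Fodd p (suc j)
F-odd p j rewrite odd-double j | half-double j = ≡.refl

F-even : ∀ p j → F p (4 ℕ.+ double j) ≡ Feven p (2 ℕ.+ j)
F-even p j rewrite odd-double j | half-double j = ≡.refl

+-exchange : ∀ a b c d e → a ℕ.+ c ≡ d ℕ.+ e → a ℕ.+ b ℕ.+ c ≡ e ℕ.+ (d ℕ.+ b)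
+-exchange a b c d e eq = ≡.trans (swap a b c) (≡.trans (cong (ℕ._+ b) eq) (rotate d e b))
  where
  open import Data.Nat using (_+_)
  open import Data.Nat.Tactic.RingSolver using (solve-∀)
  swap : ∀ a b c → a + b + c ≡ a + c + b
  swap = solve-∀
  rotate : ∀ d e b → d + e + b ≡ e + (d + b)
  rotate = solve-∀

module ThetaArithmetic {p : ℕ} (0<p : 0 ℕ.< p) where
  open import Data.Nat using (_+_; _*_; _^_)
  open import Data.Nat.Tactic.RingSolver using (solve-∀)
  open ≡ using (sym; trans)
  open ≡-Reasoning

  θ≤p^ : ∀ r → θ r p ≤ p ^ r
  θ≤p^ zero    = ℕ.≤-refl
  θ≤p^ (suc r) = ℕ.m∸n≤m (p ^ suc r) (θ r p)

  θ-+ : ∀ r → θ (suc r) p + θ r p ≡ p ^ suc r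
  θ-+ r = ℕ.m∸n+n≡m (ℕ.≤-trans (θ≤p^ r) (ℕ.m≤n*m (p ^ r) p {{ℕ.>-nonZero 0<p}}))

  θ-recurrence : ∀ r → θ (2 + r) p + θ (1 + r) p ≡ p * θ (1 + r) p + p * θ r p
  θ-recurrence r = begin
    θ (2 + r) p + θ (1 + r) p    ≡⟨ θ-+ (suc r) ⟩
    p * p ^ suc r                ≡⟨ cong (p *_) (θ-+ r) ⟨
    p * (θ (1 + r) p + θ r p)    ≡⟨ ℕ.*-distribˡ-+ p (θ (1 + r) p) (θ r p) ⟩
    p * θ (1 + r) p + p * θ r p  ∎

  θ-even-step : ∀ i → θ (suc (double i)) p + 1 ≡ p * θ (double i) p
  θ-odd-step  : ∀ i → θ (2 + double i) p ≡ suc (p * θ (suc (double i)) p)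

  θ-even-step zero    = θ-+ 0
  θ-even-step (suc i) = ℕ.+-cancelʳ-≡ (θ (2 + r) p) _ _ (begin
    θ (3 + r) p + 1 + θ (2 + r) p          ≡⟨ rearrange (θ (3 + r) p) (θ (2 + r) p) ⟩
    θ (3 + r) p + θ (2 + r) p + 1          ≡⟨ cong (_+ 1) (θ-recurrence (suc r)) ⟩
    p * θ (2 + r) p + p * θ (1 + r) p + 1  ≡⟨ ℕ.+-assoc (p * θ (2 + r) p) _ 1 ⟩
    p * θ (2 + r) p + (p * θ (1 + r) p + 1) ≡⟨ cong (_+_ (p * θ (2 + r) p)) (ℕ.+-comm _ 1) ⟩
    p * θ (2 + r) p + suc (p * θ (1 + r) p) ≡⟨ cong (_+_ (p * θ (2 + r) p)) (θ-odd-step i) ⟨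
    p * θ (2 + r) p + θ (2 + r) p           ∎)
    where
    r = double i
    rearrange : ∀ a b → a + 1 + b ≡ a + b + 1
    rearrange = solve-∀

  θ-odd-step i = ℕ.+-cancelʳ-≡ (θ (1 + r) p) _ _ (begin
    θ (2 + r) p + θ (1 + r) p              ≡⟨ θ-recurrence r ⟩
    p * θ (1 + r) p + p * θ r p            ≡⟨ cong (_+_ (p * θ (1 + r) p)) (θ-even-step i) ⟨
    p * θ (1 + r) p + (θ (1 + r) p + 1)    ≡⟨ rearrange (p * θ (1 + r) p) (θ (1 + r) p) ⟩
    suc (p * θ (1 + r) p) + θ (1 + r) p    ∎)
    where
    r = double i
    rearrange : ∀ a b → a + (b + 1) ≡ suc a + b
    rearrange = solve-∀

  θ-shift : ∀ r → p ^ suc r + θ (2 + r) p ≡ p ^ (2 + r) + θ r p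
  θ-shift r = begin
    p ^ suc r + θ (2 + r) p                   ≡⟨ cong (_+ θ (2 + r) p) (θ-+ r) ⟨
    θ (1 + r) p + θ r p + θ (2 + r) p         ≡⟨ rearrange (θ (1 + r) p) (θ r p) (θ (2 + r) p) ⟩
    θ (2 + r) p + θ (1 + r) p + θ r p         ≡⟨ cong (_+ θ r p) (θ-+ (suc r)) ⟩
    p ^ (2 + r) + θ r p                       ∎
    where
    rearrange : ∀ a b c → a + b + c ≡ c + a + b
    rearrange = solve-∀

  1+p*θ-even : ∀ i → suc p * θ (double i) p ≡ suc (p ^ suc (double i))
  1+p*θ-even i = begin
    θ r p + p * θ r p                ≡⟨ cong (_+_ (θ r p)) (θ-even-step i) ⟨
    θ r p + (θ (suc r) p + 1)        ≡⟨ rearrange (θ r p) (θ (suc r) p) ⟩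
    suc (θ (suc r) p + θ r p)        ≡⟨ cong suc (θ-+ r) ⟩
    suc (p ^ suc r)                  ∎
    where
    r = double i
    rearrange : ∀ a b → a + (b + 1) ≡ suc (b + a)
    rearrange = solve-∀

  1+p*θ-odd : ∀ i → suc (suc p * θ (suc (double i)) p) ≡ p ^ (2 + double i)
  1+p*θ-odd i = begin
    suc (θ r p + p * θ r p)          ≡⟨ ℕ.+-suc (θ r p) (p * θ r p) ⟨
    θ r p + suc (p * θ r p)          ≡⟨ cong (_+_ (θ r p)) (θ-odd-step i) ⟨
    θ r p + θ (suc r) p              ≡⟨ ℕ.+-comm (θ r p) (θ (suc r) p) ⟩
    θ (suc r) p + θ r p              ≡⟨ θ-+ r ⟩
    p ^ suc r                        ∎
    where r = suc (double i)

  three-term-exponent-even : ∀ i → let r = double i in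
    p ^ (2 + r) + (p + θ r p) ≡ suc (p ^ 2) * θ r p + suc (θ (1 + r) p)
  three-term-exponent-even i = begin
    p * p ^ suc r + (p + t)         ≡⟨ cong (λ x → p * x + (p + t)) (θ-+ r) ⟨
    p * (u + t) + (p + t)           ≡⟨ rearrange₁ p t u ⟩
    p * (u + 1) + p * t + t         ≡⟨ cong (λ x → p * x + p * t + t) (θ-even-step i) ⟩
    p * (p * t) + p * t + t         ≡⟨ rearrange₂ p t ⟩
    suc (p ^ 2) * t + p * t         ≡⟨ cong (_+_ (suc (p ^ 2) * t)) (θ-even-step i) ⟨
    suc (p ^ 2) * t + (u + 1)       ≡⟨ cong (_+_ (suc (p ^ 2) * t)) (ℕ.+-comm u 1) ⟩
    suc (p ^ 2) * t + suc u         ∎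
    where
    r = double i
    t = θ r p
    u = θ (1 + r) p
    rearrange₁ : ∀ p t u → p * (u + t) + (p + t) ≡ p * (u + 1) + p * t + t
    rearrange₁ = solve-∀
    rearrange₂ : ∀ p t → p * (p * t) + p * t + t ≡ suc (p * (p * 1)) * t + p * t
    rearrange₂ = solve-∀

  three-term-exponent-odd : ∀ i → let r = suc (double i) in
    p ^ (2 + r) + suc (θ r p) ≡ p + suc (p ^ 2) * θ r p + θ (1 + r) p
  three-term-exponent-odd i = begin
    p * p ^ suc r + suc t                   ≡⟨ cong (λ x → p * x + suc t) (θ-+ r) ⟨
    p * (u + t) + suc t                     ≡⟨ cong (λ x → p * (x + t) + suc t) (θ-odd-step i) ⟩
    p * (suc (p * t) + t) + suc t           ≡⟨ rearrange p t ⟩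
    p + suc (p ^ 2) * t + suc (p * t)       ≡⟨ cong (_+_ (p + suc (p ^ 2) * t)) (θ-odd-step i) ⟨
    p + suc (p ^ 2) * t + u                 ∎
    where
    r = suc (double i)
    t = θ r p
    u = θ (1 + r) p
    rearrange : ∀ p t → p * (suc (p * t) + t) + suc t ≡ p + suc (p * (p * 1)) * t + suc (p * t)
    rearrange = solve-∀

  private
    1+θ₁ : suc (θ 1 p) ≡ p
    1+θ₁ = trans (ℕ.+-comm 1 (θ 1 p)) (trans (θ-even-step 0) (ℕ.*-identityʳ p))

  three-term-exponent₁ : p ^ 3 + 0 ≡ suc (p ^ 2) * θ 1 p + θ 2 p
  three-term-exponent₁ = begin
    p ^ 3 + 0
      ≡⟨ subst (λ q → q ^ 3 + 0 ≡ suc (q ^ 2) * x + suc (q * x)) 1+θ₁ (rearrange x) ⟩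
    suc (p ^ 2) * x + suc (p * x)
      ≡⟨ cong (_+_ (suc (p ^ 2) * x)) (θ-odd-step 0) ⟨
    suc (p ^ 2) * x + θ 2 p ∎
    where
    x = θ 1 p
    rearrange : ∀ x → suc x * (suc x * (suc x * 1)) + 0 ≡ suc (suc x * (suc x * 1)) * x + suc (suc x * x)
    rearrange = solve-∀

  θ-shift₁ : p ^ 2 + suc (θ 3 p) ≡ p ^ 3 + p
  θ-shift₁ = begin
    p ^ 2 + suc (θ 3 p)      ≡⟨ ℕ.+-suc (p ^ 2) (θ 3 p) ⟩
    suc (p ^ 2 + θ 3 p)      ≡⟨ cong suc (θ-shift 1) ⟩
    suc (p ^ 3 + θ 1 p)      ≡⟨ ℕ.+-suc (p ^ 3) (θ 1 p) ⟨
    p ^ 3 + suc (θ 1 p)      ≡⟨ cong (_+_ (p ^ 3)) 1+θ₁ ⟩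
    p ^ 3 + p                ∎

module Recurrence {p : ℕ} (p-prime : Prime p) where
  open ThetaArithmetic (ℕ.>-nonZero⁻¹ p {{prime⇒nonZero p-prime}})
  open Modular p
    using (commutativeRing; characteristic; module Solver; coeff∼; diff-divisible; ++≡⊕; *P≡⊗; -P≡⊖)
  open Brackets p
  open Frobenius commutativeRing using (1#^; -1^pᵏ)
  open CommutativeRing commutativeRing
  open import Algebra.Properties.Semiring.Exp semiring using (_^_; ^-congˡ; ^-homo-*; ^-assocʳ)
  open import Algebra.Properties.CommutativeSemiring.Exp commutativeSemiring using (^-distrib-*)
  open import Algebra.Properties.Ring ring using (-1*x≈-x)
  open Solver using (Polynomial; solve; _:=_; _:+_; _:*_; _:-_; :-_; con)
  open import Relation.Binary.Reasoning.Setoid setoid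

  private
    𝟙 : ∀ {n} → Polynomial n
    𝟙 = con (+ 1)

  D : Poly
  D = [ 0 , 1 ]

  A : ℕ → Poly
  A n = [ 0 , n ]

  D^pᵏ : ∀ k → D ^ (p ℕ.^ k) ≈ [ k , suc k ]
  D^pᵏ k = trans ([,]^pᵏ p-prime k 0 1) (reflexive (cong₂ [_,_] (ℕ.+-identityʳ k) (ℕ.+-comm k 1)))

  A₂^pᵏ : ∀ k → A 2 ^ (p ℕ.^ k) ≈ [ k , 2 ℕ.+ k ]
  A₂^pᵏ k = trans ([,]^pᵏ p-prime k 0 2) (reflexive (cong₂ [_,_] (ℕ.+-identityʳ k) (ℕ.+-comm k 2)))

  three-term : ∀ n →
    A n * D ^ (p ℕ.^ suc n) + A (2 ℕ.+ n) * D ^ (p ℕ.^ n) ≈ A (suc n) * A 2 ^ (p ℕ.^ n)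
  three-term n = begin
    A n * D ^ (p ℕ.^ suc n) + A (2 ℕ.+ n) * D ^ (p ℕ.^ n)
      ≈⟨ +-cong (*-congˡ (D^pᵏ (suc n))) (*-congˡ (D^pᵏ n)) ⟩
    [ 0 , n ] * [ suc n , 2 ℕ.+ n ] + [ 0 , 2 ℕ.+ n ] * [ n , suc n ]
      ≈⟨ plücker 0 n (suc n) (2 ℕ.+ n) ⟩
    [ 0 , suc n ] * [ n , 2 ℕ.+ n ]
      ≈⟨ *-congˡ (A₂^pᵏ n) ⟨
    A (suc n) * A 2 ^ (p ℕ.^ n) ∎

  eliminate : ∀ {a₀ a₁ a₂ z w e₁ e₂} β → a₀ * w ^ e₁ + a₂ * w ^ e₂ ≈ a₁ * z →
              z * a₁ * w ^ β - a₀ * w ^ (e₁ ℕ.+ β) ≈ a₂ * w ^ (e₂ ℕ.+ β)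
  eliminate {a₀} {a₁} {a₂} {z} {w} {e₁} {e₂} β relation = begin
    z * a₁ * w ^ β - a₀ * w ^ (e₁ ℕ.+ β)
      ≈⟨ +-congˡ (-‿cong (*-congˡ (^-homo-* w e₁ β))) ⟩
    z * a₁ * w ^ β - a₀ * (w ^ e₁ * w ^ β)
      ≈⟨ solve 5 (λ a₀ a₁ z X B → z :* a₁ :* B :- a₀ :* (X :* B) := a₁ :* z :* B :- a₀ :* X :* B)
               refl a₀ a₁ z (w ^ e₁) (w ^ β) ⟩
    a₁ * z * w ^ β - a₀ * w ^ e₁ * w ^ β
      ≈⟨ +-congʳ (*-congʳ relation) ⟨
    (a₀ * w ^ e₁ + a₂ * w ^ e₂) * w ^ β - a₀ * w ^ e₁ * w ^ β
      ≈⟨ solve 5 (λ a₀ a₂ X Y B → (a₀ :* X :+ a₂ :* Y) :* B :- a₀ :* X :* B := a₂ :* (Y :* B))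
               refl a₀ a₂ (w ^ e₁) (w ^ e₂) (w ^ β) ⟩
    a₂ * (w ^ e₂ * w ^ β)
      ≈⟨ *-congˡ (^-homo-* w e₂ β) ⟨
    a₂ * w ^ (e₂ ℕ.+ β) ∎

  -- Each cross-multiplied instance of the recurrence is brought to the two sides of this equation.
  recurrence-step : ∀ n {β γ δ ε} c →
    p ℕ.^ suc n ℕ.+ β ≡ γ → p ℕ.^ n ℕ.+ δ ≡ p ℕ.^ suc n ℕ.+ ε →
    c * ((A 2 ^ (p ℕ.^ n) * A (suc n) * D ^ β - A n * D ^ γ) * D ^ δ) ≈ c * (A (2 ℕ.+ n) * D ^ (ε ℕ.+ γ))
  recurrence-step n {β} {δ = δ} {ε} c ≡.refl shift = *-congˡ (begin
    (A 2 ^ (p ℕ.^ n) * A (suc n) * D ^ β - A n * D ^ (p ℕ.^ suc n ℕ.+ β)) * D ^ δ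
      ≈⟨ *-congʳ (eliminate {e₁ = p ℕ.^ suc n} {e₂ = p ℕ.^ n} β (three-term n)) ⟩
    A (2 ℕ.+ n) * D ^ (p ℕ.^ n ℕ.+ β) * D ^ δ
      ≈⟨ *-assoc (A (2 ℕ.+ n)) _ _ ⟩
    A (2 ℕ.+ n) * (D ^ (p ℕ.^ n ℕ.+ β) * D ^ δ)
      ≈⟨ *-congˡ (^-homo-* D (p ℕ.^ n ℕ.+ β) δ) ⟨
    A (2 ℕ.+ n) * D ^ (p ℕ.^ n ℕ.+ β ℕ.+ δ)
      ≡⟨ cong (λ e → A (2 ℕ.+ n) * D ^ e) (+-exchange (p ℕ.^ n) β δ (p ℕ.^ suc n) ε shift) ⟩
    A (2 ℕ.+ n) * D ^ (ε ℕ.+ (p ℕ.^ suc n ℕ.+ β)) ∎)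

  -- Equality of fractions is cross-multiplication, which cannot cancel common factors without
  -- knowing that 𝔽ₚ[x,y] is a domain.  Hence numerators and denominators are tracked exactly, and
  -- m = 3, 4 (where F₁ = F₂ = 1 are not of the general shape) are computed separately.
  infix 4 _≅_/_

  record _≅_/_ (a : Frac) (n d : Poly) : Set where
    constructor represents
    field
      num≈ : num a ≈ n
      den≈ : den a ≈ d

  ≅-cong : ∀ {a n d n' d'} → a ≅ n / d → n ≈ n' → d ≈ d' → a ≅ n' / d'
  ≅-cong (represents n≈ d≈) n≈n' d≈d' = represents (trans n≈ n≈n') (trans d≈ d≈d')

  ≅-subst : ∀ {a b n d} → a ≡ b → a ≅ n / d → b ≅ n / d
  ≅-subst ≡.refl a≅n/d = a≅n/d

  ≅-poly : ∀ P → poly P ≅ P / 1#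
  ≅-poly P = represents refl refl

  ≅-neg : ∀ {a n d} → a ≅ n / d → -F a ≅ - n / d
  ≅-neg (represents n≈ d≈) = represents (trans (reflexive (-P≡⊖ _)) (-‿cong n≈)) d≈

  ≅-* : ∀ {a b n d n' d'} → a ≅ n / d → b ≅ n' / d' → a *F b ≅ n * n' / d * d'
  ≅-* (represents n≈ d≈) (represents n≈' d≈') =
    represents (trans (reflexive (*P≡⊗ _ _)) (*-cong n≈ n≈'))
               (trans (reflexive (*P≡⊗ _ _)) (*-cong d≈ d≈'))

  ≅-+ : ∀ {a b n d n' d'} → a ≅ n / d → b ≅ n' / d' → a +F b ≅ n * d' + n' * d / d * d'
  ≅-+ (represents n≈ d≈) (represents n≈' d≈') = represents
    (trans (reflexive (≡.trans (++≡⊕ _ _) (cong₂ _+_ (*P≡⊗ _ _) (*P≡⊗ _ _))))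
           (+-cong (*-cong n≈ d≈') (*-cong n≈' d≈)))
    (trans (reflexive (*P≡⊗ _ _)) (*-cong d≈ d≈'))

  ≅-inv : ∀ {a n d} → a ≅ n / d → invF a ≅ d / n
  ≅-inv (represents n≈ d≈) = represents d≈ n≈

  ≅-^ : ∀ {a n d} k → a ≅ n / d → a ^F k ≅ n ^ k / d ^ k
  ≅-^ zero    _      = represents refl refl
  ≅-^ (suc k) a≅n/d = ≅-* a≅n/d (≅-^ k a≅n/d)

  cross : ∀ {a b n d n' d'} → a ≅ n / d → b ≅ n' / d' → n * d' ≈ n' * d → a ≈[ p ] b
  cross {a} {b} {n} {d} {n'} {d'} (represents n≈ d≈) (represents n≈' d≈') cross-eq i j =
    ℤ∣.∣⇒∣ᵤ (diff-divisible (coeff∼ (begin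
      num a *P den b   ≡⟨ *P≡⊗ (num a) (den b) ⟩
      num a * den b    ≈⟨ *-cong n≈ d≈' ⟩
      n * d'           ≈⟨ cross-eq ⟩
      n' * d           ≈⟨ *-cong n≈' d≈ ⟨
      num b * den a    ≡⟨ *P≡⊗ (num b) (den a) ⟨
      num b *P den a   ∎) i j))

  σ : ℕ → Poly
  σ k = (- 1#) ^ k

  σ-square : ∀ k → σ k * σ k ≈ 1#
  σ-square k = begin
    σ k * σ k             ≈⟨ ^-distrib-* (- 1#) (- 1#) k ⟨
    (- 1# * - 1#) ^ k     ≈⟨ ^-congˡ k (solve 0 (:- 𝟙 :* :- 𝟙 := 𝟙) refl) ⟩
    1# ^ k                ≈⟨ 1#^ k ⟩
    1#                    ∎

  σ-θ-suc : ∀ r → σ (θ (suc r) p) ≈ - σ (θ r p)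
  σ-θ-suc r = begin
    σ a                      ≈⟨ *-identityʳ (σ a) ⟨
    σ a * 1#                 ≈⟨ *-congˡ (σ-square b) ⟨
    σ a * (σ b * σ b)        ≈⟨ *-assoc (σ a) (σ b) (σ b) ⟨
    σ a * σ b * σ b          ≈⟨ *-congʳ (^-homo-* (- 1#) a b) ⟨
    σ (a ℕ.+ b) * σ b        ≡⟨ cong (λ e → σ e * σ b) (θ-+ r) ⟩
    σ (p ℕ.^ suc r) * σ b    ≈⟨ *-congʳ (-1^pᵏ p-prime characteristic (suc r)) ⟩
    - 1# * σ b               ≈⟨ -1*x≈-x (σ b) ⟩
    - σ b                    ∎
    where
    a = θ (suc r) p
    b = θ r p

  σ-θ-even : ∀ i → σ (θ (double i) p) ≈ - 1#
  σ-θ-even zero    = *-identityʳ (- 1#)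
  σ-θ-even (suc i) = begin
    σ (θ (2 ℕ.+ double i) p)     ≈⟨ σ-θ-suc (suc (double i)) ⟩
    - σ (θ (suc (double i)) p)   ≈⟨ -‿cong (σ-θ-suc (double i)) ⟩
    - - σ (θ (double i) p)       ≈⟨ -‿cong (-‿cong (σ-θ-even i)) ⟩
    - - - 1#                     ≈⟨ solve 0 (:- :- :- 𝟙 := :- 𝟙) refl ⟩
    - 1#                         ∎

  σ-θ-odd : ∀ i → σ (θ (suc (double i)) p) ≈ 1#
  σ-θ-odd i = begin
    σ (θ (suc (double i)) p)     ≈⟨ σ-θ-suc (double i) ⟩
    - σ (θ (double i) p)         ≈⟨ -‿cong (σ-θ-even i) ⟩
    - - 1#                       ≈⟨ solve 0 (:- :- 𝟙 := 𝟙) refl ⟩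
    1#                           ∎

  ≅-br : ∀ i j → br p i j ≅ [ i , j ] / 1#
  ≅-br i j = represents (reflexive (≡.trans (++≡⊕ _ _) (cong (_+_ _) (-P≡⊖ _)))) refl

  ≅-sgn : ∀ k → sgn k ≅ σ k / 1#
  ≅-sgn zero    = ≅-poly 1P
  ≅-sgn (suc k) = ≅-cong (≅-neg (≅-sgn k)) (sym (-1*x≈-x (σ k))) refl

  ≅-ν : ν p ≅ - A 2 ^ suc p / D ^ suc (p ℕ.^ 2)
  ≅-ν = ≅-cong (≅-neg (≅-* (≅-* (≅-br 0 2) (≅-br 1 3)) (≅-inv (≅-* (≅-br 0 1) (≅-br 2 3)))))
    (-‿cong (begin
      A 2 * [ 1 , 3 ] * (1# * 1#)   ≈⟨ solve 2 (λ a b → a :* b :* (𝟙 :* 𝟙) := a :* b) refl (A 2) [ 1 , 3 ] ⟩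
      A 2 * [ 1 , 3 ]               ≈⟨ *-congˡ ([,]^p p-prime 0 2) ⟨
      A 2 ^ suc p                   ∎))
    (begin
      1# * 1# * (D * [ 2 , 3 ])     ≈⟨ solve 2 (λ a b → 𝟙 :* 𝟙 :* (a :* b) := a :* b) refl D [ 2 , 3 ] ⟩
      D * [ 2 , 3 ]                 ≈⟨ *-congˡ (D^pᵏ 2) ⟨
      D ^ suc (p ℕ.^ 2)             ∎)

  ≅-ν^ : ∀ t → ν p ^F t ≅ σ t * A 2 ^ (suc p ℕ.* t) / D ^ (suc (p ℕ.^ 2) ℕ.* t)
  ≅-ν^ t = ≅-cong (≅-^ t ≅-ν)
    (begin
      (- A 2 ^ suc p) ^ t               ≈⟨ ^-congˡ t (-1*x≈-x _) ⟨
      (- 1# * A 2 ^ suc p) ^ t          ≈⟨ ^-distrib-* (- 1#) (A 2 ^ suc p) t ⟩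
      σ t * (A 2 ^ suc p) ^ t           ≈⟨ *-congˡ (^-assocʳ (A 2) (suc p) t) ⟩
      σ t * A 2 ^ (suc p ℕ.* t)         ∎)
    (^-assocʳ D (suc (p ℕ.^ 2)) t)

  ≅-Fodd : ∀ k → Fodd p k ≅ σ k * A (2 ℕ.* k ℕ.+ 1) / D ^ θ (2 ℕ.* k) p
  ≅-Fodd k = ≅-cong
    (≅-* (≅-* (≅-sgn k) (≅-br 0 (2 ℕ.* k ℕ.+ 1))) (≅-inv (≅-^ (θ (2 ℕ.* k) p) (≅-br 0 1))))
    (trans (*-congˡ (1#^ (θ (2 ℕ.* k) p))) (*-identityʳ _))
    (trans (*-congʳ (*-identityʳ 1#)) (*-identityˡ _))

  ≅-Feven : ∀ k → Feven p k ≅ σ (suc k) * (D ^ p * A (2 ℕ.* k)) / D ^ suc (θ (2 ℕ.* k ∸ 1) p) * A 2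
  ≅-Feven k = ≅-cong
    (≅-* (≅-* (≅-* (≅-sgn (suc k)) (≅-* (≅-br 1 2) (≅-inv (≅-* (≅-br 0 1) (≅-br 0 2)))))
              (≅-br 0 (2 ℕ.* k)))
         (≅-inv (≅-^ e (≅-br 0 1))))
    (begin
      σ (suc k) * ([ 1 , 2 ] * (1# * 1#)) * A (2 ℕ.* k) * 1# ^ e
        ≈⟨ *-congˡ (1#^ e) ⟩
      σ (suc k) * ([ 1 , 2 ] * (1# * 1#)) * A (2 ℕ.* k) * 1#
        ≈⟨ solve 3 (λ s b a → s :* (b :* (𝟙 :* 𝟙)) :* a :* 𝟙 := s :* (b :* a))
                 refl (σ (suc k)) [ 1 , 2 ] (A (2 ℕ.* k)) ⟩
      σ (suc k) * ([ 1 , 2 ] * A (2 ℕ.* k))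
        ≈⟨ *-congˡ (*-congʳ ([,]^p p-prime 0 1)) ⟨
      σ (suc k) * (D ^ p * A (2 ℕ.* k)) ∎)
    (solve 3 (λ d a x → 𝟙 :* (𝟙 :* (d :* a)) :* 𝟙 :* x := d :* x :* a)
           refl D (A 2) (D ^ e))
    where e = θ (2 ℕ.* k ∸ 1) p

  ≅-F-odd : ∀ j → F p (3 ℕ.+ double j) ≅ σ (suc j) * A (3 ℕ.+ double j) / D ^ θ (2 ℕ.+ double j) p
  ≅-F-odd j = ≅-subst (≡.sym (F-odd p j))
    (subst₂ (λ m r → Fodd p (suc j) ≅ σ (suc j) * A m / D ^ θ r p)
            (≡.trans (ℕ.+-comm _ 1) (cong suc (2*≡double (suc j)))) (2*≡double (suc j))
            (≅-Fodd (suc j)))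

  ≅-F-even : ∀ j → F p (4 ℕ.+ double j)
                   ≅ σ (3 ℕ.+ j) * (D ^ p * A (4 ℕ.+ double j)) / D ^ suc (θ (3 ℕ.+ double j) p) * A 2
  ≅-F-even j = ≅-subst (≡.sym (F-even p j))
    (subst (λ m → Feven p (2 ℕ.+ j) ≅ σ (3 ℕ.+ j) * (D ^ p * A m) / D ^ suc (θ (m ∸ 1) p) * A 2)
           (2*≡double (2 ℕ.+ j)) (≅-Feven (2 ℕ.+ j)))

  ≅-1 : 1F ≅ 1# / 1#
  ≅-1 = ≅-poly 1P

  recurrence-3 : F p 3 ≈[ p ] (((ν p ^F θ 0 p) *F F p 2) +F F p 1)
  recurrence-3 = cross (≅-F-odd 0) (≅-+ (≅-* (≅-ν^ 1) ≅-1) ≅-1) (begin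
    σ 1 * A 3 * (D ^ suc γ * 1# * 1#)
      ≈⟨ *-congʳ (*-congʳ (σ-θ-even 0)) ⟩
    - 1# * A 3 * (D ^ suc γ * 1# * 1#)
      ≈⟨ solve 2 (λ a x → :- 𝟙 :* a :* (x :* 𝟙 :* 𝟙) := :- 𝟙 :* (a :* x))
               refl (A 3) (D ^ suc γ) ⟩
    - 1# * (A 3 * D ^ suc γ)
      ≈⟨ recurrence-step 1 (- 1#) p²+0≡γ (θ-shift 0) ⟨
    - 1# * ((z * A 2 * 1# - D * D ^ γ) * D ^ θ 2 p)
      ≈⟨ solve 5 (λ z a d x y → :- 𝟙 :* ((z :* a :* 𝟙 :- d :* x) :* y)
                             := (:- 𝟙 :* (a :* z) :* 𝟙 :* 𝟙 :+ 𝟙 :* (d :* x :* 𝟙)) :* y)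
               refl z (A 2) D (D ^ γ) (D ^ θ 2 p) ⟩
    (- 1# * (A 2 * z) * 1# * 1# + 1# * (D * D ^ γ * 1#)) * D ^ θ 2 p
      ≈⟨ *-congʳ (+-congʳ (*-congʳ (*-congʳ (*-congʳ (σ-θ-even 0))))) ⟨
    (σ 1 * (A 2 * z) * 1# * 1# + 1# * (D * D ^ γ * 1#)) * D ^ θ 2 p ∎)
    where
    γ = p ℕ.^ 2 ℕ.* 1
    z = A 2 ^ (p ℕ.* 1)
    p²+0≡γ : p ℕ.^ 2 ℕ.+ 0 ≡ γ
    p²+0≡γ = ≡.trans (ℕ.+-identityʳ (p ℕ.^ 2)) (≡.sym (ℕ.*-identityʳ (p ℕ.^ 2)))

  recurrence-4 : F p 4 ≈[ p ] (((ν p ^F θ 1 p) *F F p 3) +F F p 2)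
  recurrence-4 = cross (≅-F-even 0) (≅-+ (≅-* (≅-ν^ t) (≅-F-odd 0)) ≅-1) (begin
    σ 3 * (D ^ p * A 4) * (D ^ a * D ^ u * 1#)
      ≈⟨ solve 4 (λ x a₄ y w → :- 𝟙 :* (:- 𝟙 :* (:- 𝟙 :* 𝟙)) :* (x :* a₄) :* (y :* w :* 𝟙)
                             := :- 𝟙 :* (a₄ :* (x :* (y :* w))))
               refl (D ^ p) (A 4) (D ^ a) (D ^ u) ⟩
    - 1# * (A 4 * (D ^ p * (D ^ a * D ^ u)))
      ≈⟨ *-congˡ (*-congˡ (trans (^-homo-* D p (a ℕ.+ u)) (*-congˡ (^-homo-* D a u)))) ⟨
    - 1# * (A 4 * D ^ (p ℕ.+ (a ℕ.+ u)))
      ≈⟨ recurrence-step 2 (- 1#) three-term-exponent₁ θ-shift₁ ⟨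
    - 1# * ((z * A 3 * 1# - A 2 * D ^ (a ℕ.+ u)) * D ^ suc v)
      ≈⟨ *-congˡ (*-congʳ (+-cong (*-congʳ (*-congʳ z≈w*A₂)) (-‿cong (*-congˡ (^-homo-* D a u))))) ⟩
    - 1# * ((w * A 2 * A 3 * 1# - A 2 * (D ^ a * D ^ u)) * D ^ suc v)
      ≈⟨ solve 6 (λ w a₂ a₃ x y d → :- 𝟙 :* ((w :* a₂ :* a₃ :* 𝟙 :- a₂ :* (x :* y)) :* d)
                                 := (𝟙 :* w :* (:- 𝟙 :* a₃) :* 𝟙 :+ 𝟙 :* (x :* y)) :* (d :* a₂))
               refl w (A 2) (A 3) (D ^ a) (D ^ u) (D ^ suc v) ⟩
    (1# * w * (- 1# * A 3) * 1# + 1# * (D ^ a * D ^ u)) * (D ^ suc v * A 2)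
      ≈⟨ *-congʳ (+-congʳ (*-congʳ (*-cong (*-congʳ (σ-θ-odd 0)) (*-congʳ (σ-θ-even 0))))) ⟨
    (σ t * w * (σ 1 * A 3) * 1# + 1# * (D ^ a * D ^ u)) * (D ^ suc v * A 2) ∎)
    where
    t = θ 1 p
    u = θ 2 p
    v = θ 3 p
    a = suc (p ℕ.^ 2) ℕ.* t
    w = A 2 ^ (suc p ℕ.* t)
    z = A 2 ^ (p ℕ.^ 2)
    z≈w*A₂ : z ≈ w * A 2
    z≈w*A₂ = begin
      A 2 ^ (p ℕ.^ 2)              ≡⟨ cong (A 2 ^_) (1+p*θ-odd 0) ⟨
      A 2 ^ suc (suc p ℕ.* t)      ≈⟨ *-comm (A 2) w ⟩
      w * A 2                      ∎

  recurrence-odd : ∀ j → let n = double j in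
    F p (5 ℕ.+ n) ≈[ p ] (((ν p ^F θ (2 ℕ.+ n) p) *F F p (4 ℕ.+ n)) +F F p (3 ℕ.+ n))
  recurrence-odd j = cross (≅-F-odd (suc j)) (≅-+ (≅-* (≅-ν^ t) (≅-F-even j)) (≅-F-odd j)) (begin
    σ (2 ℕ.+ j) * A (5 ℕ.+ n) * (D ^ a * (D ^ suc u * A 2) * D ^ t)
      ≈⟨ solve 6 (λ s aₘ x y a₂ w → s :* aₘ :* (x :* (y :* a₂) :* w)
                                 := s :* a₂ :* (aₘ :* (w :* (x :* y))))
               refl (σ (2 ℕ.+ j)) (A (5 ℕ.+ n)) (D ^ a) (D ^ suc u) (A 2) (D ^ t) ⟩
    c * (A (5 ℕ.+ n) * (D ^ t * (D ^ a * D ^ suc u)))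
      ≈⟨ *-congˡ (*-congˡ (trans (^-homo-* D t (a ℕ.+ suc u)) (*-congˡ (^-homo-* D a (suc u))))) ⟨
    c * (A (5 ℕ.+ n) * D ^ (t ℕ.+ (a ℕ.+ suc u)))
      ≈⟨ recurrence-step (3 ℕ.+ n) c (three-term-exponent-even (suc j)) (θ-shift (2 ℕ.+ n)) ⟨
    c * ((z * A (4 ℕ.+ n) * D ^ (p ℕ.+ t) - A (3 ℕ.+ n) * D ^ (a ℕ.+ suc u)) * D ^ v)
      ≈⟨ *-congˡ (*-congʳ (+-cong (*-congˡ (^-homo-* D p t)) (-‿cong (*-congˡ (^-homo-* D a (suc u)))))) ⟩
    c * ((z * A (4 ℕ.+ n) * (D ^ p * D ^ t) - A (3 ℕ.+ n) * (D ^ a * D ^ suc u)) * D ^ v)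
      ≈⟨ solve 10 (λ s a₂ z b c₀ x w y u v →
           :- 𝟙 :* s :* a₂ :* ((z :* b :* (x :* w) :- c₀ :* (y :* u)) :* v)
           := (:- 𝟙 :* (a₂ :* z) :* (:- 𝟙 :* (:- 𝟙 :* s) :* (x :* b)) :* w
               :+ s :* c₀ :* (y :* (u :* a₂))) :* v)
           refl (σ (suc j)) (A 2) z (A (4 ℕ.+ n)) (A (3 ℕ.+ n)) (D ^ p) (D ^ t) (D ^ a) (D ^ suc u) (D ^ v) ⟩
    (- 1# * (A 2 * z) * (σ (3 ℕ.+ j) * (D ^ p * A (4 ℕ.+ n))) * D ^ t
      + σ (suc j) * A (3 ℕ.+ n) * (D ^ a * (D ^ suc u * A 2))) * D ^ v
      ≈⟨ *-congʳ (+-congʳ (*-congʳ (*-congʳ (*-cong (σ-θ-even (suc j)) w≈A₂*z)))) ⟨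
    (σ t * w * (σ (3 ℕ.+ j) * (D ^ p * A (4 ℕ.+ n))) * D ^ t
      + σ (suc j) * A (3 ℕ.+ n) * (D ^ a * (D ^ suc u * A 2))) * D ^ v ∎)
    where
    n = double j
    t = θ (2 ℕ.+ n) p
    u = θ (3 ℕ.+ n) p
    v = θ (4 ℕ.+ n) p
    a = suc (p ℕ.^ 2) ℕ.* t
    c = σ (2 ℕ.+ j) * A 2
    w = A 2 ^ (suc p ℕ.* t)
    z = A 2 ^ (p ℕ.^ (3 ℕ.+ n))
    w≈A₂*z : w ≈ A 2 * z
    w≈A₂*z = reflexive (cong (A 2 ^_) (1+p*θ-even (suc j)))

  recurrence-even : ∀ j → let n = double j in
    F p (6 ℕ.+ n) ≈[ p ] (((ν p ^F θ (3 ℕ.+ n) p) *F F p (5 ℕ.+ n)) +F F p (4 ℕ.+ n))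
  recurrence-even j = cross (≅-F-even (suc j)) (≅-+ (≅-* (≅-ν^ t) (≅-F-odd (suc j))) (≅-F-even j)) (begin
    σ (4 ℕ.+ j) * (D ^ p * A (6 ℕ.+ n)) * (D ^ a * D ^ u * (D ^ suc t * A 2))
      ≈⟨ solve 7 (λ s x aₘ y w r a₂ → s :* (x :* aₘ) :* (y :* w :* (r :* a₂))
                                   := s :* a₂ :* (aₘ :* (r :* (x :* y :* w))))
               refl (σ (4 ℕ.+ j)) (D ^ p) (A (6 ℕ.+ n)) (D ^ a) (D ^ u) (D ^ suc t) (A 2) ⟩
    c * (A (6 ℕ.+ n) * (D ^ suc t * (D ^ p * D ^ a * D ^ u)))
      ≈⟨ *-congˡ (*-congˡ (trans (^-homo-* D (suc t) γ) (*-congˡ D^γ))) ⟨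
    c * (A (6 ℕ.+ n) * D ^ (suc t ℕ.+ γ))
      ≈⟨ recurrence-step (4 ℕ.+ n) c (three-term-exponent-odd (suc j)) shift ⟨
    c * ((z * A (5 ℕ.+ n) * D ^ suc t - A (4 ℕ.+ n) * D ^ γ) * D ^ suc v)
      ≈⟨ *-congˡ (*-congʳ (+-cong (*-congʳ (*-congʳ z≈A₂*w)) (-‿cong (*-congˡ D^γ)))) ⟩
    c * ((A 2 * w * A (5 ℕ.+ n) * D ^ suc t - A (4 ℕ.+ n) * (D ^ p * D ^ a * D ^ u)) * D ^ suc v)
      ≈⟨ solve 10 (λ s a₂ w b c₀ r x y u v →
           :- 𝟙 :* (:- 𝟙 :* (:- 𝟙 :* s)) :* a₂
             :* ((a₂ :* w :* b :* r :- c₀ :* (x :* y :* u)) :* v)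
           := (𝟙 :* w :* (:- 𝟙 :* s :* b) :* (r :* a₂)
               :+ :- 𝟙 :* (:- 𝟙 :* s) :* (x :* c₀) :* (y :* u)) :* (v :* a₂))
           refl (σ (suc j)) (A 2) w (A (5 ℕ.+ n)) (A (4 ℕ.+ n)) (D ^ suc t) (D ^ p) (D ^ a) (D ^ u) (D ^ suc v) ⟩
    (1# * w * (σ (2 ℕ.+ j) * A (5 ℕ.+ n)) * (D ^ suc t * A 2)
      + σ (3 ℕ.+ j) * (D ^ p * A (4 ℕ.+ n)) * (D ^ a * D ^ u)) * (D ^ suc v * A 2)
      ≈⟨ *-congʳ (+-congʳ (*-congʳ (*-congʳ (*-congʳ (σ-θ-odd (suc j)))))) ⟨
    (σ t * w * (σ (2 ℕ.+ j) * A (5 ℕ.+ n)) * (D ^ suc t * A 2)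
      + σ (3 ℕ.+ j) * (D ^ p * A (4 ℕ.+ n)) * (D ^ a * D ^ u)) * (D ^ suc v * A 2) ∎)
    where
    n = double j
    t = θ (3 ℕ.+ n) p
    u = θ (4 ℕ.+ n) p
    v = θ (5 ℕ.+ n) p
    a = suc (p ℕ.^ 2) ℕ.* t
    γ = p ℕ.+ a ℕ.+ u
    c = σ (4 ℕ.+ j) * A 2
    w = A 2 ^ (suc p ℕ.* t)
    z = A 2 ^ (p ℕ.^ (4 ℕ.+ n))
    D^γ : D ^ γ ≈ D ^ p * D ^ a * D ^ u
    D^γ = trans (^-homo-* D (p ℕ.+ a) u) (*-congʳ (^-homo-* D p a))
    z≈A₂*w : z ≈ A 2 * w
    z≈A₂*w = reflexive (cong (A 2 ^_) (≡.sym (1+p*θ-odd (suc j))))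
    shift : p ℕ.^ (4 ℕ.+ n) ℕ.+ suc v ≡ p ℕ.^ (5 ℕ.+ n) ℕ.+ suc t
    shift = ≡.trans (ℕ.+-suc _ v) (≡.trans (cong suc (θ-shift (3 ℕ.+ n))) (≡.sym (ℕ.+-suc _ t)))


proposition6p3 : (p : ℕ) → Prime p → (m : ℕ) → 3 ≤ m →
    F p m ≈[ p ] (((ν p ^F θ (m ∸ 3) p) *F F p (m ∸ 1)) +F F p (m ∸ 2))
proposition6p3 p p-prime (suc zero) (ℕ.s≤s ())
proposition6p3 p p-prime (suc (suc zero)) (ℕ.s≤s (ℕ.s≤s ()))
proposition6p3 p p-prime (suc (suc (suc n))) _ with halving n
... | twice zero      = Recurrence.recurrence-3 p-prime
... | twice+1 zero    = Recurrence.recurrence-4 p-prime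
... | twice (suc j)   = Recurrence.recurrence-odd p-prime j
... | twice+1 (suc j) = Recurrence.recurrence-even p-prime j
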